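{- Let $L$ be a lattice and $A\subset L$ a saturated sublattice (i.e. $L/A$ is torsion free) such that the orthogonal projection of $L$ onto $A\otimes\mathbb{R}$ has image exactly $A^\sharp$. Let $B=L\cap A^\perp$. Then $B$ is even if and only if $A$ contains a characteristic vector of $L$.
   Context: A lattice is an integral Euclidean lattice (positive definite $\mathbb{Z}$-valued symmetric bilinear form $x\cdot y$); $A^\sharp$ is the dual of $A$ in $A\otimes\mathbb{R}$. A lattice is even if all norms $x\cdot x$ are even. A characteristic vector of $L$ is an element $\xi\in L^\sharp$ such that $x\cdot\xi\equiv x\cdot x\pmod 2$ for all $x\in L$. -}

module Defs where

open import Data.Nat using (ℕ; zero; suc)
open import Data.Fin using (Fin; zero; suc)
open import Data.Integer as ℤ using (ℤ; +_; 0ℤ)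
open import Data.Integer.Divisibility using () renaming (_∣_ to _∣ℤ_)
open import Data.Rational as ℚ using (ℚ; 0ℚ)
open import Data.Product using (Σ; ∃; _×_)
open import Relation.Binary.PropositionalEquality using (_≡_; _≢_)
open import Relation.Nullary using (¬_)

sumℤ : ∀ {n} → (Fin n → ℤ) → ℤ
sumℤ {zero}  f = 0ℤ
sumℤ {suc n} f = f zero ℤ.+ sumℤ (λ i → f (suc i))

sumℚ : ∀ {n} → (Fin n → ℚ) → ℚ
sumℚ {zero}  f = 0ℚ
sumℚ {suc n} f = f zero ℚ.+ sumℚ (λ i → f (suc i))

-- The lattice L is ℤ^n (coordinates w.r.t. a basis) with Gram matrix G.
Gram : ℕ → Set
Gram n = Fin n → Fin n → ℤ

Vecℤ : ℕ → Set
Vecℤ n = Fin n → ℤ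

Vecℚ : ℕ → Set
Vecℚ n = Fin n → ℚ

ι : ℤ → ℚ
ι z = z ℚ./ 1

ιv : ∀ {n} → Vecℤ n → Vecℚ n
ιv x i = ι (x i)

dotℤ : ∀ {n} → Gram n → Vecℤ n → Vecℤ n → ℤ
dotℤ G x y = sumℤ (λ i → sumℤ (λ j → x i ℤ.* G i j ℤ.* y j))

dotℚ : ∀ {n} → Gram n → Vecℚ n → Vecℚ n → ℚ
dotℚ G u v = sumℚ (λ i → sumℚ (λ j → u i ℚ.* ι (G i j) ℚ.* v j))

IsLattice : ∀ {n} → Gram n → Set
IsLattice {n} G =
  (∀ i j → G i j ≡ G j i) ×
  (∀ (x : Vecℤ n) → (∃ λ i → x i ≢ 0ℤ) → 0ℤ ℤ.< dotℤ G x x)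

-- The sublattice A ⊆ L generated by g₁,…,g_k.
Gens : ℕ → ℕ → Set
Gens n k = Fin k → Vecℤ n

InA : ∀ {n k} → Gens n k → Vecℤ n → Set
InA {n} {k} g x = ∃ λ (c : Fin k → ℤ) → ∀ j → x j ≡ sumℤ (λ i → c i ℤ.* g i j)

-- membership in A ⊗ ℚ (the rational span; A ⊗ ℝ ∩ (L⊗ℚ))
InAℚ : ∀ {n k} → Gens n k → Vecℚ n → Set
InAℚ {n} {k} g y = ∃ λ (c : Fin k → ℚ) → ∀ j → y j ≡ sumℚ (λ i → c i ℚ.* ι (g i j))

Saturated : ∀ {n k} → Gens n k → Set
Saturated {n} g = ∀ (m : ℤ) (x : Vecℤ n) → m ≢ 0ℤ → InA g (λ j → m ℤ.* x j) → InA g x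

InDualA : ∀ {n k} → Gram n → Gens n k → Vecℚ n → Set
InDualA {n} G g y = InAℚ g y × (∀ (a : Vecℤ n) → InA g a → ∃ λ (z : ℤ) → dotℚ G y (ιv a) ≡ ι z)

IsProjA : ∀ {n k} → Gram n → Gens n k → Vecℤ n → Vecℚ n → Set
IsProjA {n} G g x y = InAℚ g y × (∀ (a : Vecℤ n) → InA g a → dotℚ G (ιv x) (ιv a) ≡ dotℚ G y (ιv a))

ProjImageIsDual : ∀ {n k} → Gram n → Gens n k → Set
ProjImageIsDual {n} G g =
  ∀ (y : Vecℚ n) → (InDualA G g y → ∃ λ (x : Vecℤ n) → IsProjA G g x y)
                 × ((∃ λ (x : Vecℤ n) → IsProjA G g x y) → InDualA G g y)

InB : ∀ {n k} → Gram n → Gens n k → Vecℤ n → Set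
InB {n} G g x = ∀ (a : Vecℤ n) → InA g a → dotℤ G x a ≡ 0ℤ

BEven : ∀ {n k} → Gram n → Gens n k → Set
BEven {n} G g = ∀ (x : Vecℤ n) → InB G g x → (+ 2) ∣ℤ dotℤ G x x

IsCharacteristic : ∀ {n} → Gram n → Vecℤ n → Set
IsCharacteristic {n} G ξ = ∀ (x : Vecℤ n) → (+ 2) ∣ℤ (dotℤ G x ξ ℤ.- dotℤ G x x)

-- Reduce modulo 2. Over 𝔽₂ the norm x ↦ x · x becomes linear, namely x ↦ x · diag(G), and
-- x ↦ x · gᵢ becomes x ↦ x · Wᵢ with Wᵢ = G gᵢ mod 2. Hence A contains a characteristic vector
-- iff diag(G) lies in the 𝔽₂-span of the Wᵢ. If it does not, Gaussian elimination over 𝔽₂ gives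
-- x ∈ L with x · A ⊆ 2ℤ and x · x odd. The integral functional a ↦ (x · a)/2 on A is represented
-- by a vector of A♯ (found in A ⊗ ℚ by Gram–Schmidt, which works over ℤ up to a denominator since
-- G is positive definite), and as A♯ is the image of the projection it is x′ · a for some x′ ∈ L.
-- Then x − 2x′ ∈ B has odd norm. Conversely, for x ∈ B and ξ ∈ A characteristic,
-- x · x ≡ x · ξ = 0 mod 2.

module Submission where

open import Algebra.Bundles using (CommutativeRing)
import Algebra.Properties.CommutativeSemigroup as CommutativeSemigroupₚ
open import Data.Bool using (Bool; true; false; _xor_; _∧_)
open import Data.Bool.Properties
  using (_≟_; xor-∧-commutativeRing; ¬-not; ∧-comm; ∧-identityʳ; xor-same; xor-identityʳ)
open import Data.Empty using (⊥-elim)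
open import Data.Fin using (Fin; zero; suc)
open import Data.Fin.Properties using (all?; ¬∀⟶∃¬)
open import Data.Integer as ℤ using (ℤ; +_; -[1+_]; 0ℤ; -1ℤ; +<+)
open import Data.Integer.DivMod using (a≡a%ℕn+[a/ℕn]*n; n%ℕd<d)
open import Data.Integer.Divisibility using () renaming (_∣_ to _∣ℤ_)
import Data.Integer.Divisibility.Signed as Signed
import Data.Integer.Properties as ℤₚ
open import Data.Integer.Tactic.RingSolver using (solve-∀)
open import Data.Maybe using (just; nothing)
open import Data.Nat as ℕ using (ℕ; zero; suc; s≤s)
open import Data.Nat.Divisibility using () renaming (_∣_ to _∣ℕ_)
open import Data.Product using (∃; _×_; _,_; proj₁; proj₂)
open import Data.Rational as ℚ using (ℚ; 1ℚ)
import Data.Rational.Properties as ℚₚ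
open import Data.Rational.Unnormalised as ℚᵘ using (mkℚᵘ)
import Data.Rational.Unnormalised.Properties as ℚᵘₚ
open import Data.Sum using (_⊎_; inj₁; inj₂)
open import Data.Vec.Functional using (_∷_)
open import Defs
open import Function.Bundles using (_⇔_; mk⇔)
open import Level using (0ℓ)
open import Relation.Binary.PropositionalEquality
open import Relation.Nullary using (Dec; yes; no; ¬_)
import Tactic.RingSolver as RingSolver
open import Tactic.RingSolver.Core.AlmostCommutativeRing using (AlmostCommutativeRing; fromCommutativeRing)

module BilinearForms {c ℓ} (R : CommutativeRing c ℓ) where

  open CommutativeRing R hiding (zero; setoid) renaming (refl to ≈-refl; sym to ≈-sym; trans to ≈-trans)
  open import Algebra.Properties.Semiring.Sum semiring public
    using (sum; sum-cong-≋; ∑-comm; ∑-distrib-+; *-distribˡ-sum; sum-replicate-zero)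
  open CommutativeSemigroupₚ *-commutativeSemigroup using (x∙yz≈y∙xz; xy∙z≈zy∙x)
  open import Relation.Binary.Reasoning.Setoid (CommutativeRing.setoid R)

  private
    variable
      k n : ℕ

  infix 7 _⬝_

  _⬝_ : (u v : Fin n → Carrier) → Carrier
  u ⬝ v = sum (λ j → u j * v j)

  comb : (Fin k → Carrier) → (Fin k → Fin n → Carrier) → Fin n → Carrier
  comb c h j = c ⬝ (λ i → h i j)

  form : (Fin n → Fin n → Carrier) → (Fin n → Carrier) → (Fin n → Carrier) → Carrier
  form M x y = sum (λ i → sum (λ j → x i * M i j * y j))

  basis : Fin n → Fin n → Carrier
  basis zero    zero    = 1#
  basis zero    (suc _) = 0#
  basis (suc _) zero    = 0#
  basis (suc p) (suc j) = basis p j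

  ⬝-cong : ∀ {u u′ v v′ : Fin n → Carrier} →
           (∀ j → u j ≈ u′ j) → (∀ j → v j ≈ v′ j) → u ⬝ v ≈ u′ ⬝ v′
  ⬝-cong {n} u≈u′ v≈v′ = sum-cong-≋ {n} (λ j → *-cong (u≈u′ j) (v≈v′ j))

  ⬝-congʳ : ∀ (u : Fin n → Carrier) {v v′} → (∀ j → v j ≈ v′ j) → u ⬝ v ≈ u ⬝ v′
  ⬝-congʳ u v≈v′ = ⬝-cong (λ _ → ≈-refl) v≈v′

  ⬝-comm : (u v : Fin n → Carrier) → u ⬝ v ≈ v ⬝ u
  ⬝-comm {n} u v = sum-cong-≋ {n} (λ j → *-comm (u j) (v j))

  ⬝-zeroʳ : (u : Fin n → Carrier) {v : Fin n → Carrier} → (∀ j → v j ≈ 0#) → u ⬝ v ≈ 0#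
  ⬝-zeroʳ {n} u v≈0 = ≈-trans (sum-cong-≋ {n} (λ j → ≈-trans (*-congˡ (v≈0 j)) (zeroʳ (u j))))
                             (sum-replicate-zero n)

  ⬝-zeroˡ : (v : Fin n → Carrier) → (λ _ → 0#) ⬝ v ≈ 0#
  ⬝-zeroˡ {n} v = ≈-trans (sum-cong-≋ {n} (λ j → zeroˡ (v j))) (sum-replicate-zero n)

  ⬝-+ʳ : ∀ (u v w : Fin n → Carrier) → u ⬝ (λ j → v j + w j) ≈ u ⬝ v + u ⬝ w
  ⬝-+ʳ {n} u v w =
    ≈-trans (sum-cong-≋ {n} (λ j → distribˡ (u j) (v j) (w j))) (∑-distrib-+ {n} _ _)

  ⬝-*ʳ : ∀ (u : Fin n → Carrier) a v → u ⬝ (λ j → a * v j) ≈ a * (u ⬝ v)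
  ⬝-*ʳ {n} u a v = ≈-trans (sum-cong-≋ {n} (λ j → x∙yz≈y∙xz (u j) a (v j)))
                           (≈-sym (*-distribˡ-sum {n} a (λ j → u j * v j)))

  ⬝-+ˡ : ∀ (u v w : Fin n → Carrier) → (λ j → u j + v j) ⬝ w ≈ u ⬝ w + v ⬝ w
  ⬝-+ˡ u v w = ≈-trans (⬝-comm _ w) (≈-trans (⬝-+ʳ w u v) (+-cong (⬝-comm w u) (⬝-comm w v)))

  ⬝-*ˡ : ∀ a (u v : Fin n → Carrier) → (λ j → a * u j) ⬝ v ≈ a * (u ⬝ v)
  ⬝-*ˡ a u v = ≈-trans (⬝-comm _ v) (≈-trans (⬝-*ʳ v a u) (*-congˡ (⬝-comm v u)))

  ⬝-basisˡ : (p : Fin n) (v : Fin n → Carrier) → basis p ⬝ v ≈ v p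
  ⬝-basisˡ {suc n} zero v = begin
    1# * v zero + sum (λ j → 0# * v (suc j)) ≈⟨ +-cong (*-identityˡ _) (⬝-zeroˡ (λ j → v (suc j))) ⟩
    v zero + 0#                               ≈⟨ +-identityʳ _ ⟩
    v zero                                    ∎
  ⬝-basisˡ (suc p) v = ≈-trans (+-cong (zeroˡ _) (⬝-basisˡ p (λ j → v (suc j)))) (+-identityˡ _)

  ⬝-comb : ∀ (u : Fin n → Carrier) (c : Fin k → Carrier) h →
           u ⬝ comb c h ≈ c ⬝ (λ i → u ⬝ h i)
  ⬝-comb {n} {k} u c h = begin
    sum (λ j → u j * sum (λ i → c i * h i j))
      ≈⟨ sum-cong-≋ {n} (λ j → *-distribˡ-sum {k} (u j) (λ i → c i * h i j)) ⟩
    sum (λ j → sum (λ i → u j * (c i * h i j)))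
      ≈⟨ ∑-comm {n} {k} _ ⟩
    sum (λ i → sum (λ j → u j * (c i * h i j)))
      ≈⟨ sum-cong-≋ {k} (λ i → sum-cong-≋ {n} (λ j → x∙yz≈y∙xz _ _ _)) ⟩
    sum (λ i → sum (λ j → c i * (u j * h i j)))
      ≈⟨ sum-cong-≋ {k} (λ i → ≈-sym (*-distribˡ-sum {n} (c i) (λ j → u j * h i j))) ⟩
    sum (λ i → c i * (u ⬝ h i)) ∎

  form-⬝ : ∀ M (x y : Fin n → Carrier) → form M x y ≈ x ⬝ (λ i → M i ⬝ y)
  form-⬝ {n} M x y = sum-cong-≋ {n} (λ i → ≈-trans (sum-cong-≋ {n} (λ j → *-assoc (x i) _ _))
                                                  (≈-sym (*-distribˡ-sum {n} (x i) (λ j → M i j * y j))))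

  form-cong : ∀ M {x x′ y y′ : Fin n → Carrier} →
              (∀ i → x i ≈ x′ i) → (∀ j → y j ≈ y′ j) → form M x y ≈ form M x′ y′
  form-cong {n} M x≈x′ y≈y′ =
    sum-cong-≋ {n} (λ i → sum-cong-≋ {n} (λ j → *-cong (*-congʳ (x≈x′ i)) (y≈y′ j)))

  form-sym : ∀ {M} → (∀ i j → M i j ≈ M j i) → (x y : Fin n → Carrier) → form M x y ≈ form M y x
  form-sym {n} {M} M-sym x y = ≈-trans (∑-comm {n} {n} _) (sum-cong-≋ {n} (λ j → sum-cong-≋ {n} (λ i →
    ≈-trans (xy∙z≈zy∙x (x i) _ _) (*-congʳ (*-congˡ (M-sym i j))))))

  form-zeroʳ : ∀ M (x : Fin n → Carrier) {y} → (∀ j → y j ≈ 0#) → form M x y ≈ 0#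
  form-zeroʳ M x y≈0 = ≈-trans (form-⬝ M x _) (⬝-zeroʳ x (λ i → ⬝-zeroʳ (M i) y≈0))

  form-+ˡ : ∀ M (x y v : Fin n → Carrier) → form M (λ i → x i + y i) v ≈ form M x v + form M y v
  form-+ˡ M x y v = begin
    form M (λ i → x i + y i) v                 ≈⟨ form-⬝ M _ v ⟩
    (λ i → x i + y i) ⬝ (λ i → M i ⬝ v)         ≈⟨ ⬝-+ˡ x y _ ⟩
    x ⬝ (λ i → M i ⬝ v) + y ⬝ (λ i → M i ⬝ v)   ≈⟨ +-cong (form-⬝ M x v) (form-⬝ M y v) ⟨
    form M x v + form M y v                    ∎

  form-*ˡ : ∀ M a (x v : Fin n → Carrier) → form M (λ i → a * x i) v ≈ a * form M x v
  form-*ˡ M a x v = begin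
    form M (λ i → a * x i) v         ≈⟨ form-⬝ M _ v ⟩
    (λ i → a * x i) ⬝ (λ i → M i ⬝ v) ≈⟨ ⬝-*ˡ a x _ ⟩
    a * (x ⬝ (λ i → M i ⬝ v))         ≈⟨ *-congˡ (form-⬝ M x v) ⟨
    a * form M x v                   ∎

  form-combʳ : ∀ M (x : Fin n → Carrier) (c : Fin k → Carrier) h →
               form M x (comb c h) ≈ c ⬝ (λ l → form M x (h l))
  form-combʳ M x c h = begin
    form M x (comb c h)                           ≈⟨ form-⬝ M x _ ⟩
    x ⬝ (λ i → M i ⬝ comb c h)                     ≈⟨ ⬝-congʳ x (λ i → ⬝-comb (M i) c h) ⟩
    x ⬝ comb c (λ l i → M i ⬝ h l)                 ≈⟨ ⬝-comb x c _ ⟩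
    c ⬝ (λ l → x ⬝ (λ i → M i ⬝ h l))              ≈⟨ ⬝-congʳ c (λ l → ≈-sym (form-⬝ M x (h l))) ⟩
    c ⬝ (λ l → form M x (h l))                    ∎

  sum-symmetric : (∀ a → a + a ≈ 0#) → (A : Fin n → Fin n → Carrier) →
                  (∀ i j → A i j ≈ A j i) → sum (λ i → sum (λ j → A i j)) ≈ sum (λ i → A i i)
  sum-symmetric {zero}  _     _ _     = ≈-refl
  sum-symmetric {suc n} char2 A A-sym = begin
    (A zero zero + r) + sum (λ i → A (suc i) zero + sum (λ j → A (suc i) (suc j)))
      ≈⟨ +-congˡ (∑-distrib-+ {n} (λ i → A (suc i) zero) _) ⟩
    (A zero zero + r) + (sum (λ i → A (suc i) zero) + sum (λ i → sum (λ j → A (suc i) (suc j))))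
      ≈⟨ +-congˡ (+-cong (sum-cong-≋ {n} (λ i → A-sym (suc i) zero))
                         (sum-symmetric char2 (λ i j → A (suc i) (suc j)) (λ i j → A-sym (suc i) (suc j)))) ⟩
    (A zero zero + r) + (r + sum (λ i → A (suc i) (suc i)))
      ≈⟨ cancel (A zero zero) r _ ⟩
    A zero zero + sum (λ i → A (suc i) (suc i)) ∎
    where
    r = sum (λ j → A zero (suc j))
    cancel : ∀ a r t → (a + r) + (r + t) ≈ a + t
    cancel a r t = begin
      (a + r) + (r + t) ≈⟨ +-assoc a r _ ⟩
      a + (r + (r + t)) ≈⟨ +-congˡ (≈-sym (+-assoc r r t)) ⟩
      a + ((r + r) + t) ≈⟨ +-congˡ (≈-trans (+-congʳ (char2 r)) (+-identityˡ t)) ⟩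
      a + t             ∎

module Homomorphism {a ℓa b ℓb} (R : CommutativeRing a ℓa) (S : CommutativeRing b ℓb)
  (h : CommutativeRing.Carrier R → CommutativeRing.Carrier S)
  (+-homo : ∀ x y →
    CommutativeRing._≈_ S (h (CommutativeRing._+_ R x y)) (CommutativeRing._+_ S (h x) (h y)))
  (*-homo : ∀ x y →
    CommutativeRing._≈_ S (h (CommutativeRing._*_ R x y)) (CommutativeRing._*_ S (h x) (h y)))
  (0#-homo : CommutativeRing._≈_ S (h (CommutativeRing.0# R)) (CommutativeRing.0# S))
  where

  private
    module R = BilinearForms R
    module S where
      open CommutativeRing S public
      open BilinearForms S public

  sum-homo : ∀ {n} (f : Fin n → CommutativeRing.Carrier R) → h (R.sum f) S.≈ S.sum (λ i → h (f i))
  sum-homo {zero}  f = 0#-homo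
  sum-homo {suc n} f = S.trans (+-homo _ _) (S.+-congˡ (sum-homo (λ i → f (suc i))))

  form-homo : ∀ {n} M (x y : Fin n → CommutativeRing.Carrier R) →
              h (R.form M x y) S.≈ S.form (λ i j → h (M i j)) (λ i → h (x i)) (λ j → h (y j))
  form-homo {n} M x y = S.trans (sum-homo {n} _) (S.sum-cong-≋ {n} (λ i → S.trans (sum-homo {n} _)
    (S.sum-cong-≋ {n} (λ j → S.trans (*-homo _ _) (S.*-congʳ (*-homo _ _))))))

  ⬝-homo : ∀ {n} (u v : Fin n → CommutativeRing.Carrier R) →
           h (R._⬝_ u v) S.≈ S._⬝_ (λ j → h (u j)) (λ j → h (v j))
  ⬝-homo {n} u v = S.trans (sum-homo {n} _) (S.sum-cong-≋ {n} (λ j → *-homo (u j) (v j)))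

bit : Bool → ℤ
bit false = 0ℤ
bit true  = + 1

parity : ℤ → Bool
parity z = z ℤ.%ℕ 2 ℕ.≡ᵇ 1

parity-decomposition : ∀ z → z ≡ bit (parity z) ℤ.+ (z ℤ./ℕ 2) ℤ.* + 2
parity-decomposition z =
  trans (a≡a%ℕn+[a/ℕn]*n z 2) (cong (ℤ._+ (z ℤ./ℕ 2) ℤ.* + 2) (remainder (n%ℕd<d z 2)))
  where
  remainder : ∀ {r} → r ℕ.< 2 → + r ≡ bit (r ℕ.≡ᵇ 1)
  remainder {zero}  _ = refl
  remainder {suc zero} _ = refl
  remainder {suc (suc _)} (s≤s (s≤s ()))

odd≢even : ∀ p q → + 1 ℤ.+ p ℤ.* + 2 ≢ 0ℤ ℤ.+ q ℤ.* + 2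
odd≢even p q e = 2*≢1 (q ℤ.- p) (begin
  (q ℤ.- p) ℤ.* + 2                         ≡⟨ difference p q ⟩
  (0ℤ ℤ.+ q ℤ.* + 2) ℤ.- p ℤ.* + 2          ≡⟨ cong (ℤ._- p ℤ.* + 2) (sym e) ⟩
  (+ 1 ℤ.+ p ℤ.* + 2) ℤ.- p ℤ.* + 2         ≡⟨ cancel p ⟩
  + 1                                       ∎)
  where
  open ≡-Reasoning
  2*≢1 : ∀ t → t ℤ.* + 2 ≢ + 1
  2*≢1 (+ zero)  ()
  2*≢1 (+ suc _) ()
  2*≢1 -[1+ _ ]  ()
  difference : ∀ p q → (q ℤ.- p) ℤ.* + 2 ≡ (0ℤ ℤ.+ q ℤ.* + 2) ℤ.- p ℤ.* + 2
  difference = solve-∀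
  cancel : ∀ p → (+ 1 ℤ.+ p ℤ.* + 2) ℤ.- p ℤ.* + 2 ≡ + 1
  cancel = solve-∀

bit-injective-mod-2 : ∀ b c q p → bit b ℤ.+ q ℤ.* + 2 ≡ bit c ℤ.+ p ℤ.* + 2 → b ≡ c
bit-injective-mod-2 false false _ _ _ = refl
bit-injective-mod-2 true  true  _ _ _ = refl
bit-injective-mod-2 false true  q p e = ⊥-elim (odd≢even p q (sym e))
bit-injective-mod-2 true  false q p e = ⊥-elim (odd≢even q p e)

parity-unique : ∀ {z} b q → z ≡ bit b ℤ.+ q ℤ.* + 2 → parity z ≡ b
parity-unique {z} b q e =
  bit-injective-mod-2 (parity z) b (z ℤ./ℕ 2) q (trans (sym (parity-decomposition z)) e)

bit-+ : ∀ a b → bit a ℤ.+ bit b ≡ bit (a xor b) ℤ.+ bit (a ∧ b) ℤ.* + 2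
bit-+ false false = refl
bit-+ false true  = refl
bit-+ true  false = refl
bit-+ true  true  = refl

bit-* : ∀ a b → bit a ℤ.* bit b ≡ bit (a ∧ b)
bit-* false false = refl
bit-* false true  = refl
bit-* true  false = refl
bit-* true  true  = refl

parity-bit : ∀ b → parity (bit b) ≡ b
parity-bit false = refl
parity-bit true  = refl

parity-+ : ∀ a b → parity (a ℤ.+ b) ≡ parity a xor parity b
parity-+ a b = parity-unique _ (qa ℤ.+ qb ℤ.+ Y) (begin
  a ℤ.+ b                                   ≡⟨ cong₂ ℤ._+_ (parity-decomposition a) (parity-decomposition b) ⟩
  (A ℤ.+ qa ℤ.* + 2) ℤ.+ (B ℤ.+ qb ℤ.* + 2) ≡⟨ collect A B qa qb ⟩
  (A ℤ.+ B) ℤ.+ (qa ℤ.+ qb) ℤ.* + 2         ≡⟨ cong (ℤ._+ (qa ℤ.+ qb) ℤ.* + 2) (bit-+ (parity a) (parity b)) ⟩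
  (X ℤ.+ Y ℤ.* + 2) ℤ.+ (qa ℤ.+ qb) ℤ.* + 2 ≡⟨ carry X Y qa qb ⟩
  X ℤ.+ (qa ℤ.+ qb ℤ.+ Y) ℤ.* + 2           ∎)
  where
  open ≡-Reasoning
  A = bit (parity a)
  B = bit (parity b)
  X = bit (parity a xor parity b)
  Y = bit (parity a ∧ parity b)
  qa = a ℤ./ℕ 2
  qb = b ℤ./ℕ 2
  collect : ∀ A B qa qb → (A ℤ.+ qa ℤ.* + 2) ℤ.+ (B ℤ.+ qb ℤ.* + 2) ≡ (A ℤ.+ B) ℤ.+ (qa ℤ.+ qb) ℤ.* + 2
  collect = solve-∀
  carry : ∀ X Y qa qb → (X ℤ.+ Y ℤ.* + 2) ℤ.+ (qa ℤ.+ qb) ℤ.* + 2 ≡ X ℤ.+ (qa ℤ.+ qb ℤ.+ Y) ℤ.* + 2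
  carry = solve-∀

parity-* : ∀ a b → parity (a ℤ.* b) ≡ parity a ∧ parity b
parity-* a b = parity-unique _ Q (begin
  a ℤ.* b                                   ≡⟨ cong₂ ℤ._*_ (parity-decomposition a) (parity-decomposition b) ⟩
  (A ℤ.+ qa ℤ.* + 2) ℤ.* (B ℤ.+ qb ℤ.* + 2) ≡⟨ expand A B qa qb ⟩
  A ℤ.* B ℤ.+ Q ℤ.* + 2                     ≡⟨ cong (ℤ._+ Q ℤ.* + 2) (bit-* (parity a) (parity b)) ⟩
  bit (parity a ∧ parity b) ℤ.+ Q ℤ.* + 2   ∎)
  where
  open ≡-Reasoning
  A = bit (parity a)
  B = bit (parity b)
  qa = a ℤ./ℕ 2
  qb = b ℤ./ℕ 2
  Q = qa ℤ.* B ℤ.+ qb ℤ.* A ℤ.+ qa ℤ.* qb ℤ.* + 2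
  expand : ∀ A B qa qb → (A ℤ.+ qa ℤ.* + 2) ℤ.* (B ℤ.+ qb ℤ.* + 2) ≡
                         A ℤ.* B ℤ.+ (qa ℤ.* B ℤ.+ qb ℤ.* A ℤ.+ qa ℤ.* qb ℤ.* + 2) ℤ.* + 2
  expand = solve-∀

parity-neg : ∀ a → parity (ℤ.- a) ≡ parity a
parity-neg a = parity-unique _ (ℤ.- (a ℤ./ℕ 2) ℤ.- bit (parity a))
  (trans (cong ℤ.-_ (parity-decomposition a)) (negate (bit (parity a)) (a ℤ./ℕ 2)))
  where
  negate : ∀ A q → ℤ.- (A ℤ.+ q ℤ.* + 2) ≡ A ℤ.+ (ℤ.- q ℤ.- A) ℤ.* + 2
  negate = solve-∀

parity≡false⇒halvable : ∀ {z} → parity z ≡ false → z ≡ (z ℤ./ℕ 2) ℤ.* + 2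
parity≡false⇒halvable {z} e =
  trans (parity-decomposition z) (trans (cong (λ b → bit b ℤ.+ (z ℤ./ℕ 2) ℤ.* + 2) e) (ℤₚ.+-identityˡ _))

parity≡false⇒2∣ : ∀ {z} → parity z ≡ false → + 2 ∣ℤ z
parity≡false⇒2∣ {z} e = Signed.∣⇒∣ᵤ {+ 2} {z} (Signed.divides (z ℤ./ℕ 2) (parity≡false⇒halvable e))

2∣⇒parity≡false : ∀ {z} → + 2 ∣ℤ z → parity z ≡ false
2∣⇒parity≡false {z} 2∣z with Signed.∣ᵤ⇒∣ {+ 2} {z} 2∣z
... | Signed.divides q e = parity-unique false q (trans e (sym (ℤₚ.+-identityˡ _)))

ι-toℚᵘ : ∀ z → ℚ.toℚᵘ (ι z) ℚᵘ.≃ mkℚᵘ z 0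
ι-toℚᵘ z = ℚₚ.toℚᵘ-fromℚᵘ (mkℚᵘ z 0)

ι-+ : ∀ a b → ι (a ℤ.+ b) ≡ ι a ℚ.+ ι b
ι-+ a b = ℚₚ.toℚᵘ-injective (begin-equality
  ℚ.toℚᵘ (ι (a ℤ.+ b))            ≃⟨ ι-toℚᵘ (a ℤ.+ b) ⟩
  mkℚᵘ (a ℤ.+ b) 0               ≃⟨ ℚᵘ.*≡* (ℤ-identity a b) ⟩
  mkℚᵘ a 0 ℚᵘ.+ mkℚᵘ b 0          ≃⟨ ℚᵘₚ.+-cong (ι-toℚᵘ a) (ι-toℚᵘ b) ⟨
  ℚ.toℚᵘ (ι a) ℚᵘ.+ ℚ.toℚᵘ (ι b)  ≃⟨ ℚₚ.toℚᵘ-homo-+ (ι a) (ι b) ⟨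
  ℚ.toℚᵘ (ι a ℚ.+ ι b)            ∎)
  where
  open ℚᵘₚ.≤-Reasoning
  ℤ-identity : ∀ a b → (a ℤ.+ b) ℤ.* (+ 1 ℤ.* + 1) ≡ (a ℤ.* + 1 ℤ.+ b ℤ.* + 1) ℤ.* + 1
  ℤ-identity = solve-∀

ι-* : ∀ a b → ι (a ℤ.* b) ≡ ι a ℚ.* ι b
ι-* a b = ℚₚ.toℚᵘ-injective (begin-equality
  ℚ.toℚᵘ (ι (a ℤ.* b))            ≃⟨ ι-toℚᵘ (a ℤ.* b) ⟩
  mkℚᵘ (a ℤ.* b) 0               ≃⟨ ℚᵘ.*≡* (ℤ-identity a b) ⟩
  mkℚᵘ a 0 ℚᵘ.* mkℚᵘ b 0          ≃⟨ ℚᵘₚ.*-cong (ι-toℚᵘ a) (ι-toℚᵘ b) ⟨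
  ℚ.toℚᵘ (ι a) ℚᵘ.* ℚ.toℚᵘ (ι b)  ≃⟨ ℚₚ.toℚᵘ-homo-* (ι a) (ι b) ⟨
  ℚ.toℚᵘ (ι a ℚ.* ι b)            ∎)
  where
  open ℚᵘₚ.≤-Reasoning
  ℤ-identity : ∀ a b → (a ℤ.* b) ℤ.* (+ 1 ℤ.* + 1) ≡ (a ℤ.* b) ℤ.* + 1
  ℤ-identity = solve-∀

ι-injective : ∀ {a b} → ι a ≡ ι b → a ≡ b
ι-injective {a} {b} ιa≡ιb with ℚᵘₚ.≃-trans (ℚᵘₚ.≃-sym (ι-toℚᵘ a))
                                 (ℚᵘₚ.≃-trans (ℚₚ.toℚᵘ-cong ιa≡ιb) (ι-toℚᵘ b))
... | ℚᵘ.*≡* a*1≡b*1 = trans (sym (ℤₚ.*-identityʳ a)) (trans a*1≡b*1 (ℤₚ.*-identityʳ b))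

1/n*n≡1 : ∀ m → (+ 1 ℚ./ suc m) ℚ.* ι (+ suc m) ≡ 1ℚ
1/n*n≡1 m = ℚₚ.toℚᵘ-injective (begin-equality
  ℚ.toℚᵘ ((+ 1 ℚ./ suc m) ℚ.* ι (+ suc m))
    ≃⟨ ℚₚ.toℚᵘ-homo-* (+ 1 ℚ./ suc m) (ι (+ suc m)) ⟩
  ℚ.toℚᵘ (+ 1 ℚ./ suc m) ℚᵘ.* ℚ.toℚᵘ (ι (+ suc m))
    ≃⟨ ℚᵘₚ.*-cong (ℚₚ.toℚᵘ-fromℚᵘ (mkℚᵘ (+ 1) m)) (ι-toℚᵘ (+ suc m)) ⟩
  mkℚᵘ (+ 1) m ℚᵘ.* mkℚᵘ (+ suc m) 0
    ≃⟨ ℚᵘ.*≡* (ℤ-identity (+ suc m)) ⟩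
  ℚ.toℚᵘ 1ℚ ∎)
  where
  open ℚᵘₚ.≤-Reasoning
  ℤ-identity : ∀ t → (+ 1 ℤ.* t) ℤ.* + 1 ≡ + 1 ℤ.* (t ℤ.* + 1)
  ℤ-identity = solve-∀

same-parity⇒2∣- : ∀ {a b} → parity a ≡ parity b → + 2 ∣ℤ (a ℤ.- b)
same-parity⇒2∣- {a} {b} pa≡pb = parity≡false⇒2∣ {a ℤ.- b} (begin
  parity (a ℤ.+ ℤ.- b)             ≡⟨ parity-+ a (ℤ.- b) ⟩
  parity a xor parity (ℤ.- b)      ≡⟨ cong₂ _xor_ pa≡pb (parity-neg b) ⟩
  parity b xor parity b            ≡⟨ xor-same (parity b) ⟩
  false                            ∎)
  where open ≡-Reasoning

module 𝔽₂ = BilinearForms xor-∧-commutativeRing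
open 𝔽₂ using (_⬝_; comb; basis; ⬝-basisˡ; ⬝-zeroʳ; ⬝-+ˡ; ⬝-*ˡ; ⬝-+ʳ; ⬝-*ʳ; ⬝-congʳ)

-- The solver computes coefficients in Bool, so it knows that 1 + 1 = 0.
𝔽₂-ring : AlmostCommutativeRing 0ℓ 0ℓ
𝔽₂-ring = fromCommutativeRing xor-∧-commutativeRing λ { false → just refl ; true → nothing }

zero-or-pivot : ∀ {n} (v : Fin n → Bool) → (∀ j → v j ≡ false) ⊎ ∃ λ p → v p ≡ true
zero-or-pivot {n} v with all? (λ j → v j ≟ false)
... | yes v≡0 = inj₁ v≡0
... | no  v≢0 with ¬∀⟶∃¬ n _ (λ j → v j ≟ false) v≢0
...   | p , vp≢0 = inj₂ (p , ¬-not vp≢0)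

InSpan : ∀ {k n} → (Fin k → Fin n → Bool) → (Fin n → Bool) → Set
InSpan W d = ∃ λ c → ∀ j → d j ≡ comb c W j

Separated : ∀ {k n} → (Fin k → Fin n → Bool) → (Fin n → Bool) → Set
Separated W d = ∃ λ x → (∀ i → x ⬝ W i ≡ false) × x ⬝ d ≡ true

eliminate : ∀ {n} → Fin n → (w v : Fin n → Bool) → Fin n → Bool
eliminate p w v j = v j xor (v p ∧ w j)

⬝-eliminate : ∀ {n} (x : Fin n → Bool) p w v → x ⬝ eliminate p w v ≡ x ⬝ v xor (v p ∧ x ⬝ w)
⬝-eliminate x p w v = trans (⬝-+ʳ x v _) (cong (x ⬝ v xor_) (⬝-*ʳ x (v p) w))

comb-eliminate : ∀ {k n} (c : Fin k → Bool) p w (h : Fin k → Fin n → Bool) j →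
                 comb c (λ i → eliminate p w (h i)) j ≡ comb c h j xor (comb c h p ∧ w j)
comb-eliminate c p w h j = begin
  c ⬝ (λ i → h i j xor (h i p ∧ w j))      ≡⟨ ⬝-congʳ c (λ i → cong (h i j xor_) (∧-comm (h i p) (w j))) ⟩
  c ⬝ (λ i → h i j xor (w j ∧ h i p))      ≡⟨ ⬝-+ʳ c (λ i → h i j) _ ⟩
  comb c h j xor (c ⬝ (λ i → w j ∧ h i p)) ≡⟨ cong (comb c h j xor_) (⬝-*ʳ c (w j) (λ i → h i p)) ⟩
  comb c h j xor (w j ∧ comb c h p)        ≡⟨ cong (comb c h j xor_) (∧-comm (w j) _) ⟩
  comb c h j xor (comb c h p ∧ w j)        ∎
  where open ≡-Reasoning

⬝-eliminate-adjoint : ∀ {n} (x : Fin n → Bool) p w v →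
                      (λ j → x j xor ((x ⬝ w) ∧ basis p j)) ⬝ v ≡ x ⬝ eliminate p w v
⬝-eliminate-adjoint x p w v = begin
  (λ j → x j xor ((x ⬝ w) ∧ basis p j)) ⬝ v ≡⟨ ⬝-+ˡ x _ v ⟩
  x ⬝ v xor ((λ j → (x ⬝ w) ∧ basis p j) ⬝ v) ≡⟨ cong (x ⬝ v xor_) (⬝-*ˡ (x ⬝ w) (basis p) v) ⟩
  x ⬝ v xor ((x ⬝ w) ∧ (basis p ⬝ v))      ≡⟨ cong (λ b → x ⬝ v xor ((x ⬝ w) ∧ b)) (⬝-basisˡ p v) ⟩
  x ⬝ v xor ((x ⬝ w) ∧ v p)                ≡⟨ cong (x ⬝ v xor_) (∧-comm (x ⬝ w) (v p)) ⟩
  x ⬝ v xor (v p ∧ x ⬝ w)                  ≡⟨ ⬝-eliminate x p w v ⟨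
  x ⬝ eliminate p w v                      ∎
  where open ≡-Reasoning

module Pivot {k n} (W : Fin (suc k) → Fin n → Bool) (d : Fin n → Bool) (p : Fin n) where
  private
    w = W zero
    Ws = λ i → W (suc i)

  open ≡-Reasoning

  span-lift : InSpan (λ i → eliminate p w (Ws i)) (eliminate p w d) → InSpan W d
  span-lift (c , d′≡c) = (d p xor comb c Ws p) ∷ c , λ j → begin
    d j                                                   ≡⟨ cancel (d j) (d p ∧ w j) ⟩
    eliminate p w d j xor (d p ∧ w j)                     ≡⟨ cong (_xor (d p ∧ w j)) (d′≡c j) ⟩
    comb c (λ i → eliminate p w (Ws i)) j xor (d p ∧ w j)
      ≡⟨ cong (_xor (d p ∧ w j)) (comb-eliminate c p w Ws j) ⟩
    (comb c Ws j xor (comb c Ws p ∧ w j)) xor (d p ∧ w j) ≡⟨ regroup (comb c Ws j) (comb c Ws p) (d p) (w j) ⟩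
    ((d p xor comb c Ws p) ∧ w j) xor comb c Ws j         ∎
    where
    cancel : ∀ a b → a ≡ (a xor b) xor b
    cancel = RingSolver.solve-∀ 𝔽₂-ring
    regroup : ∀ a b e f → (a xor (b ∧ f)) xor (e ∧ f) ≡ ((e xor b) ∧ f) xor a
    regroup = RingSolver.solve-∀ 𝔽₂-ring

  separated-lift : w p ≡ true →
                   Separated (λ i → eliminate p w (Ws i)) (eliminate p w d) → Separated W d
  separated-lift wp≡1 (x , x⊥W′ , x⬝d′) = x′ , x′⊥W , trans (⬝-eliminate-adjoint x p w d) x⬝d′
    where
    x′ = λ j → x j xor ((x ⬝ w) ∧ basis p j)
    x′⊥W : ∀ i → x′ ⬝ W i ≡ false
    x′⊥W zero    = trans (⬝-eliminate-adjoint x p w w) (⬝-zeroʳ x (λ j → begin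
      w j xor (w p ∧ w j)  ≡⟨ cong (λ b → w j xor (b ∧ w j)) wp≡1 ⟩
      w j xor w j          ≡⟨ xor-same (w j) ⟩
      false                ∎))
    x′⊥W (suc i) = trans (⬝-eliminate-adjoint x p w (Ws i)) (x⊥W′ i)

span-or-separated : ∀ {n} k (W : Fin k → Fin n → Bool) d → InSpan W d ⊎ Separated W d
span-or-separated zero W d with zero-or-pivot d
... | inj₁ d≡0      = inj₁ ((λ ()) , d≡0)
... | inj₂ (p , dp) = inj₂ (basis p , (λ ()) , trans (⬝-basisˡ p d) dp)
span-or-separated (suc k) W d with zero-or-pivot (W zero)
... | inj₁ W₀≡0 with span-or-separated k (λ i → W (suc i)) d
...   | inj₁ (c , d≡c)       = inj₁ (false ∷ c , d≡c)
...   | inj₂ (x , x⊥W , x⬝d) = inj₂ (x , (λ { zero → ⬝-zeroʳ x W₀≡0 ; (suc i) → x⊥W i }) , x⬝d)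
span-or-separated (suc k) W d | inj₂ (p , W₀p)
  with span-or-separated k (λ i → eliminate p (W zero) (W (suc i))) (eliminate p (W zero) d)
... | inj₁ span      = inj₁ (Pivot.span-lift W d p span)
... | inj₂ separated = inj₂ (Pivot.separated-lift W d p W₀p separated)

form-diagonal : ∀ {n} {M : Fin n → Fin n → Bool} → (∀ i j → M i j ≡ M j i) →
                ∀ x → 𝔽₂.form M x x ≡ x ⬝ (λ j → M j j)
form-diagonal {n} {M} M-sym x =
  trans (𝔽₂.sum-symmetric xor-same (λ i j → (x i ∧ M i j) ∧ x j) entries-sym)
        (𝔽₂.sum-cong-≋ {n} (λ i → idempotent (x i) (M i i)))
  where
  swap : ∀ a m b → (a ∧ m) ∧ b ≡ (b ∧ m) ∧ a
  swap = RingSolver.solve-∀ 𝔽₂-ring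
  entries-sym : ∀ i j → (x i ∧ M i j) ∧ x j ≡ (x j ∧ M j i) ∧ x i
  entries-sym i j = trans (cong (λ m → (x i ∧ m) ∧ x j) (M-sym i j)) (swap (x i) (M j i) (x j))
  idempotent : ∀ a m → (a ∧ m) ∧ a ≡ a ∧ m
  idempotent false m = refl
  idempotent true  m = ∧-identityʳ m

module ℤF = BilinearForms ℤₚ.+-*-commutativeRing
module ℚF = BilinearForms ℚₚ.+-*-commutativeRing
open ℤF using () renaming (_⬝_ to _⬝ℤ_)
module ParityHom =
  Homomorphism ℤₚ.+-*-commutativeRing xor-∧-commutativeRing parity parity-+ parity-* refl
module ιHom = Homomorphism ℤₚ.+-*-commutativeRing ℚₚ.+-*-commutativeRing ι ι-+ ι-* refl

sumℤ≡sum : ∀ {n} (f : Fin n → ℤ) → sumℤ f ≡ ℤF.sum f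
sumℤ≡sum {zero}  f = refl
sumℤ≡sum {suc n} f = cong (λ s → f zero ℤ.+ s) (sumℤ≡sum (λ i → f (suc i)))

sumℚ≡sum : ∀ {n} (f : Fin n → ℚ) → sumℚ f ≡ ℚF.sum f
sumℚ≡sum {zero}  f = refl
sumℚ≡sum {suc n} f = cong (f zero ℚ.+_) (sumℚ≡sum (λ i → f (suc i)))

dotℤ≡form : ∀ {n} (G : Gram n) x y → dotℤ G x y ≡ ℤF.form G x y
dotℤ≡form {n} G x y =
  trans (sumℤ≡sum {n} _) (ℤF.sum-cong-≋ {n} (λ i → sumℤ≡sum {n} (λ j → x i ℤ.* G i j ℤ.* y j)))

dotℚ≡form : ∀ {n} (G : Gram n) u v → dotℚ G u v ≡ ℚF.form (λ i j → ι (G i j)) u v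
dotℚ≡form {n} G u v =
  trans (sumℚ≡sum {n} _) (ℚF.sum-cong-≋ {n} (λ i → sumℚ≡sum {n} (λ j → u i ℚ.* ι (G i j) ℚ.* v j)))

parity-dotℤ : ∀ {n} (G : Gram n) x y →
  parity (dotℤ G x y) ≡ 𝔽₂.form (λ i j → parity (G i j)) (λ i → parity (x i)) (λ j → parity (y j))
parity-dotℤ G x y = trans (cong parity (dotℤ≡form G x y)) (ParityHom.form-homo G x y)

ι-dotℤ : ∀ {n} (G : Gram n) x y → ι (dotℤ G x y) ≡ dotℚ G (ιv x) (ιv y)
ι-dotℤ G x y =
  trans (cong ι (dotℤ≡form G x y)) (trans (ιHom.form-homo G x y) (sym (dotℚ≡form G (ιv x) (ιv y))))

InA-intro : ∀ {n k} {g : Gens n k} {a} c → (∀ j → a j ≡ ℤF.comb c g j) → InA g a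
InA-intro {k = k} {g} c a≡cg = c , λ j → trans (a≡cg j) (sym (sumℤ≡sum {k} (λ i → c i ℤ.* g i j)))

InA-elim : ∀ {n k} {g : Gens n k} {a} ((c , _) : InA g a) → ∀ j → a j ≡ ℤF.comb c g j
InA-elim {k = k} {g} (c , a≡cg) j = trans (a≡cg j) (sumℤ≡sum {k} (λ i → c i ℤ.* g i j))

InA-generator : ∀ {n k} (g : Gens n k) i → InA g (g i)
InA-generator g i = InA-intro (ℤF.basis i) (λ j → sym (ℤF.⬝-basisˡ i (λ l → g l j)))

InA-tail : ∀ {n k} {g : Gens n (suc k)} {a} → InA (λ i → g (suc i)) a → InA g a
InA-tail (c , a≡cg) = 0ℤ ∷ c , λ j → trans (a≡cg j) (sym (ℤₚ.+-identityˡ _))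

InA-linear : ∀ {n k} {g : Gens n k} {u v} → InA g u → InA g v →
             ∀ a b → InA g (λ j → a ℤ.* u j ℤ.+ b ℤ.* v j)
InA-linear {g = g} {u} {v} u∈A v∈A a b = InA-intro (λ i → a ℤ.* cu i ℤ.+ b ℤ.* cv i) λ j → begin
  a ℤ.* u j ℤ.+ b ℤ.* v j
    ≡⟨ cong₂ (λ p q → a ℤ.* p ℤ.+ b ℤ.* q) (InA-elim u∈A j) (InA-elim v∈A j) ⟩
  a ℤ.* ℤF.comb cu g j ℤ.+ b ℤ.* ℤF.comb cv g j
    ≡⟨ cong₂ ℤ._+_ (ℤF.⬝-*ˡ a cu (λ i → g i j)) (ℤF.⬝-*ˡ b cv (λ i → g i j)) ⟨
  ℤF.comb (λ i → a ℤ.* cu i) g j ℤ.+ ℤF.comb (λ i → b ℤ.* cv i) g j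
    ≡⟨ ℤF.⬝-+ˡ (λ i → a ℤ.* cu i) (λ i → b ℤ.* cv i) (λ i → g i j) ⟨
  ℤF.comb (λ i → a ℤ.* cu i ℤ.+ b ℤ.* cv i) g j ∎
  where
  open ≡-Reasoning
  cu = proj₁ u∈A
  cv = proj₁ v∈A

positive⇒suc : ∀ {z} → 0ℤ ℤ.< z → ∃ λ m → z ≡ + suc m
positive⇒suc {+ suc m}  _         = m , refl
positive⇒suc {+ zero}   (+<+ ())
positive⇒suc { -[1+ _ ]} ()

module Lattice {n} (G : Gram n) (lattice : IsLattice G) where

  private
    G-sym = proj₁ lattice
    G-pos = proj₂ lattice
    open CommutativeSemigroupₚ ℤₚ.*-commutativeSemigroup using (x∙yz≈y∙xz)
    open import Data.Integer using (_+_; _*_; -_)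

  infix 7 _·_

  _·_ : Vecℤ n → Vecℤ n → ℤ
  x · y = dotℤ G x y

  ·-sym : ∀ x y → x · y ≡ y · x
  ·-sym x y = trans (dotℤ≡form G x y) (trans (ℤF.form-sym G-sym x y) (sym (dotℤ≡form G y x)))

  ·-congʳ : ∀ x {y y′} → (∀ j → y j ≡ y′ j) → x · y ≡ x · y′
  ·-congʳ x {y} {y′} y≡y′ =
    trans (dotℤ≡form G x y) (trans (ℤF.form-cong G {x} {x} (λ _ → refl) y≡y′) (sym (dotℤ≡form G x y′)))

  ·-+ˡ : ∀ x y v → (λ j → x j + y j) · v ≡ x · v + y · v
  ·-+ˡ x y v = trans (dotℤ≡form G (λ j → x j + y j) v)
    (trans (ℤF.form-+ˡ G x y v) (sym (cong₂ _+_ (dotℤ≡form G x v) (dotℤ≡form G y v))))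

  ·-*ˡ : ∀ a x v → (λ j → a * x j) · v ≡ a * (x · v)
  ·-*ˡ a x v = trans (dotℤ≡form G (λ j → a * x j) v)
    (trans (ℤF.form-*ˡ G a x v) (sym (cong (a *_) (dotℤ≡form G x v))))

  ·-linearˡ : ∀ a b x y v → (λ j → a * x j + b * y j) · v ≡ a * (x · v) + b * (y · v)
  ·-linearˡ a b x y v =
    trans (·-+ˡ (λ j → a * x j) (λ j → b * y j) v) (cong₂ _+_ (·-*ˡ a x v) (·-*ˡ b y v))

  ·-linearʳ : ∀ a b x y v → v · (λ j → a * x j + b * y j) ≡ a * (v · x) + b * (v · y)
  ·-linearʳ a b x y v = trans (·-sym v _) (trans (·-linearˡ a b x y v)
    (cong₂ (λ p q → a * p + b * q) (·-sym x v) (·-sym y v)))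

  ·-zeroʳ : ∀ x {y} → (∀ j → y j ≡ 0ℤ) → x · y ≡ 0ℤ
  ·-zeroʳ x y≡0 = trans (dotℤ≡form G x _) (ℤF.form-zeroʳ G x y≡0)

  ·-span : ∀ {k} {g : Gens n k} {a} x ((c , _) : InA g a) → x · a ≡ c ⬝ℤ (λ i → x · g i)
  ·-span {g = g} {a} x (c , a≡cg) = begin
    x · a                          ≡⟨ ·-congʳ x (InA-elim (c , a≡cg)) ⟩
    x · ℤF.comb c g                ≡⟨ dotℤ≡form G x _ ⟩
    ℤF.form G x (ℤF.comb c g)      ≡⟨ ℤF.form-combʳ G x c g ⟩
    c ⬝ℤ (λ i → ℤF.form G x (g i)) ≡⟨ ℤF.⬝-congʳ c (λ i → sym (dotℤ≡form G x (g i))) ⟩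
    c ⬝ℤ (λ i → x · g i)           ∎
    where open ≡-Reasoning

  orthogonal⇒InB : ∀ {k} {g : Gens n k} {x} → (∀ i → x · g i ≡ 0ℤ) → InB G g x
  orthogonal⇒InB {x = x} x⊥g a a∈A = trans (·-span x a∈A) (ℤF.⬝-zeroʳ (proj₁ a∈A) x⊥g)

  scaled-agreement : ∀ {k} {g : Gens n k} s x y → (∀ i → s * (x · g i) ≡ y · g i) →
                     ∀ a → InA g a → s * (x · a) ≡ y · a
  scaled-agreement {g = g} s x y sx≡y a a∈A@(c , _) = begin
    s * (x · a)                ≡⟨ cong (s *_) (·-span x a∈A) ⟩
    s * (c ⬝ℤ (λ i → x · g i)) ≡⟨ ℤF.⬝-*ʳ c s _ ⟨
    c ⬝ℤ (λ i → s * (x · g i)) ≡⟨ ℤF.⬝-congʳ c sx≡y ⟩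
    c ⬝ℤ (λ i → y · g i)       ≡⟨ ·-span y a∈A ⟨
    y · a                      ∎
    where open ≡-Reasoning

  -- P / (1 + d) is the orthogonal projection of x onto A ⊗ ℚ.
  record ScaledProjection {k} (g : Gens n k) (x : Vecℤ n) : Set where
    field
      d      : ℕ
      P      : Vecℤ n
      P∈A    : InA g P
      scaled : ∀ i → + suc d * (x · g i) ≡ P · g i

  module GramSchmidtStep {k} (g : Gens n (suc k)) (x : Vecℤ n)
    (px : ScaledProjection (λ i → g (suc i)) x)
    (pg₀ : ScaledProjection (λ i → g (suc i)) (g zero)) where

    open ScaledProjection px
    open ScaledProjection pg₀ renaming (d to e; P to Q; P∈A to Q∈A; scaled to scaledg₀)
    open ≡-Reasoning

    private
      g₀ = g zero
      g′ = λ i → g (suc i)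
      D = + suc d
      E = + suc e

    H : Vecℤ n
    H j = E * g₀ j + -1ℤ * Q j

    E·g₀ : ∀ v → E * (v · g₀) ≡ v · H + v · Q
    E·g₀ v = begin
      E * (v · g₀)                            ≡⟨ regroup (E * (v · g₀)) (v · Q) ⟩
      (E * (v · g₀) + -1ℤ * (v · Q)) + v · Q  ≡⟨ cong (_+ v · Q) (·-linearʳ E -1ℤ g₀ Q v) ⟨
      v · H + v · Q                           ∎
      where
      regroup : ∀ a q → a ≡ (a + -1ℤ * q) + q
      regroup = solve-∀

    H⊥A′ : ∀ i → H · g′ i ≡ 0ℤ
    H⊥A′ i = begin
      H · g′ i                                     ≡⟨ ·-linearˡ E -1ℤ g₀ Q (g′ i) ⟩
      E * (g₀ · g′ i) + -1ℤ * (Q · g′ i)           ≡⟨ cong (λ q → E * (g₀ · g′ i) + -1ℤ * q) (scaledg₀ i) ⟨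
      E * (g₀ · g′ i) + -1ℤ * (E * (g₀ · g′ i))    ≡⟨ cancel (E * (g₀ · g′ i)) ⟩
      0ℤ                                           ∎
      where
      cancel : ∀ a → a + -1ℤ * a ≡ 0ℤ
      cancel = solve-∀

    P·H≡0 : P · H ≡ 0ℤ
    P·H≡0 = trans (·-sym P H) (orthogonal⇒InB {g = g′} {H} H⊥A′ P P∈A)

    H·Q≡0 : H · Q ≡ 0ℤ
    H·Q≡0 = orthogonal⇒InB {g = g′} {H} H⊥A′ Q Q∈A

    D[x·Q]≡P·Q : D * (x · Q) ≡ P · Q
    D[x·Q]≡P·Q = scaled-agreement D x P scaled Q Q∈A

    degenerate : (∀ j → H j ≡ 0ℤ) → ScaledProjection g x
    degenerate H≡0 = record
      { d      = d
      ; P      = P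
      ; P∈A    = InA-tail {g = g} P∈A
      ; scaled = λ { zero → at-g₀ ; (suc i) → scaled i }
      }
      where
      at-g₀ : D * (x · g₀) ≡ P · g₀
      at-g₀ = ℤₚ.*-cancelˡ-≡ E _ _ (begin
        E * (D * (x · g₀))   ≡⟨ x∙yz≈y∙xz E D (x · g₀) ⟩
        D * (E * (x · g₀))   ≡⟨ cong (D *_) (E·g₀ x) ⟩
        D * (x · H + x · Q)  ≡⟨ cong (λ h → D * (h + x · Q)) (·-zeroʳ x H≡0) ⟩
        D * (0ℤ + x · Q)     ≡⟨ cong (D *_) (ℤₚ.+-identityˡ (x · Q)) ⟩
        D * (x · Q)          ≡⟨ D[x·Q]≡P·Q ⟩
        P · Q                ≡⟨ ℤₚ.+-identityˡ (P · Q) ⟨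
        0ℤ + P · Q           ≡⟨ cong (_+ P · Q) P·H≡0 ⟨
        P · H + P · Q        ≡⟨ E·g₀ P ⟨
        E * (P · g₀)         ∎)

    H∈A : InA g H
    H∈A = InA-linear {g = g} (InA-generator g zero) (InA-tail {g = g} Q∈A) E -1ℤ

    -- P′ / DN = P / D + (t / N) H is the Gram–Schmidt update, and 1 + d′ = (1 + d)(1 + m) = DN.
    nondegenerate : ∀ m → H · H ≡ + suc m → ScaledProjection g x
    nondegenerate m H·H≡N = record
      { d      = m ℕ.+ d ℕ.* suc m
      ; P      = P′
      ; P∈A    = InA-linear {g = g} (InA-tail {g = g} P∈A) H∈A N (D * t)
      ; scaled = λ { zero → at-g₀ ; (suc i) → at-g′ i }
      }
      where
      N = + suc m
      t = x · H
      P′ : Vecℤ n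
      P′ j = N * P j + (D * t) * H j

      at-g′ : ∀ i → D * N * (x · g′ i) ≡ P′ · g′ i
      at-g′ i = begin
        D * N * (x · g′ i)                    ≡⟨ rearrange D N (x · g′ i) ⟩
        N * (D * (x · g′ i))                  ≡⟨ cong (N *_) (scaled i) ⟩
        N * (P · g′ i)                        ≡⟨ pad (N * (P · g′ i)) (D * t) ⟩
        N * (P · g′ i) + (D * t) * 0ℤ         ≡⟨ cong (λ h → N * (P · g′ i) + (D * t) * h) (H⊥A′ i) ⟨
        N * (P · g′ i) + (D * t) * (H · g′ i) ≡⟨ ·-linearˡ N (D * t) P H (g′ i) ⟨
        P′ · g′ i                             ∎
        where
        rearrange : ∀ D N a → D * N * a ≡ N * (D * a)
        rearrange = solve-∀
        pad : ∀ a b → a ≡ a + b * 0ℤ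
        pad = solve-∀

      at-g₀ : D * N * (x · g₀) ≡ P′ · g₀
      at-g₀ = ℤₚ.*-cancelˡ-≡ E _ _ (begin
        E * (D * N * (x · g₀))
          ≡⟨ x∙yz≈y∙xz E (D * N) (x · g₀) ⟩
        D * N * (E * (x · g₀))
          ≡⟨ cong (D * N *_) (E·g₀ x) ⟩
        D * N * (t + x · Q)
          ≡⟨ expand D N t (x · Q) ⟩
        D * N * t + N * (D * (x · Q))
          ≡⟨ cong (λ q → D * N * t + N * q) D[x·Q]≡P·Q ⟩
        D * N * t + N * (P · Q)
          ≡⟨ regroup D N t (P · Q) ⟩
        N * (0ℤ + P · Q) + D * t * (N + 0ℤ)
          ≡⟨ cong₂ (λ a b → N * (a + P · Q) + D * t * b) (sym P·H≡0) (cong₂ _+_ (sym H·H≡N) (sym H·Q≡0)) ⟩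
        N * (P · H + P · Q) + D * t * (H · H + H · Q)
          ≡⟨ cong₂ (λ a b → N * a + D * t * b) (E·g₀ P) (E·g₀ H) ⟨
        N * (E * (P · g₀)) + D * t * (E * (H · g₀))
          ≡⟨ factor E N (D * t) (P · g₀) (H · g₀) ⟩
        E * (N * (P · g₀) + D * t * (H · g₀))
          ≡⟨ cong (E *_) (·-linearˡ N (D * t) P H g₀) ⟨
        E * (P′ · g₀) ∎)
        where
        expand : ∀ D N t q → D * N * (t + q) ≡ D * N * t + N * (D * q)
        expand = solve-∀
        regroup : ∀ D N t p → D * N * t + N * p ≡ N * (0ℤ + p) + D * t * (N + 0ℤ)
        regroup = solve-∀
        factor : ∀ E N s a b → N * (E * a) + s * (E * b) ≡ E * (N * a + s * b)
        factor = solve-∀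

  scaled-projection : ∀ {k} (g : Gens n k) x → ScaledProjection g x
  scaled-projection {zero}  g x =
    record { d = 0 ; P = λ _ → 0ℤ ; P∈A = (λ ()) , (λ _ → refl) ; scaled = λ () }
  scaled-projection {suc k} g x = extend (all? (λ j → H j ℤ.≟ 0ℤ))
    where
    open GramSchmidtStep g x (scaled-projection (λ i → g (suc i)) x)
                             (scaled-projection (λ i → g (suc i)) (g zero))
    extend : Dec (∀ j → H j ≡ 0ℤ) → ScaledProjection g x
    extend (yes H≡0) = degenerate H≡0
    extend (no  H≢0) = let (m , H·H≡N) = positive⇒suc (G-pos H (¬∀⟶∃¬ n _ (λ j → H j ℤ.≟ 0ℤ) H≢0))
                       in nondegenerate m H·H≡N

  dual-representative : ∀ {k} (g : Gens n k) x s (m : Fin k → ℤ) → (∀ i → x · g i ≡ + suc s * m i) →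
                        ∃ λ y → InDualA G g y × ∀ i → dotℚ G y (ιv (g i)) ≡ ι (m i)
  dual-representative {k} g x s m x·g≡sm =
    y , (y∈Aℚ , λ a a∈A → proj₁ a∈A ⬝ℤ m , y·a a a∈A) ,
    λ i → trans (y·a (g i) (InA-generator g i)) (cong ι (ℤF.⬝-basisˡ i m))
    where
    open ScaledProjection (scaled-projection g x)
    open ≡-Reasoning
    S = + suc s
    D = + suc d
    M = d ℕ.+ s ℕ.* suc d
    r = + 1 ℚ./ suc M
    y : Vecℚ n
    y j = r ℚ.* ι (P j)

    r-cancels : ∀ z → r ℚ.* ι (S * D * z) ≡ ι z
    r-cancels z = begin
      r ℚ.* ι (+ suc M * z)        ≡⟨ cong (r ℚ.*_) (ι-* (+ suc M) z) ⟩
      r ℚ.* (ι (+ suc M) ℚ.* ι z)  ≡⟨ ℚₚ.*-assoc r _ _ ⟨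
      (r ℚ.* ι (+ suc M)) ℚ.* ι z  ≡⟨ cong (ℚ._* ι z) (1/n*n≡1 M) ⟩
      1ℚ ℚ.* ι z                   ≡⟨ ℚₚ.*-identityˡ (ι z) ⟩
      ι z                          ∎

    P·a : ∀ a ((c , _) : InA g a) → P · a ≡ S * D * (c ⬝ℤ m)
    P·a a a∈A@(c , _) = begin
      P · a                     ≡⟨ scaled-agreement D x P scaled a a∈A ⟨
      D * (x · a)               ≡⟨ cong (D *_) (trans (·-span x a∈A) (ℤF.⬝-congʳ c x·g≡sm)) ⟩
      D * (c ⬝ℤ (λ i → S * m i)) ≡⟨ cong (D *_) (ℤF.⬝-*ʳ c S m) ⟩
      D * (S * (c ⬝ℤ m))       ≡⟨ rearrange D S (c ⬝ℤ m) ⟩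
      S * D * (c ⬝ℤ m)          ∎
      where
      rearrange : ∀ D S z → D * (S * z) ≡ S * D * z
      rearrange = solve-∀

    y·a : ∀ a ((c , _) : InA g a) → dotℚ G y (ιv a) ≡ ι (c ⬝ℤ m)
    y·a a a∈A@(c , _) = begin
      dotℚ G y (ιv a)                 ≡⟨ dotℚ≡form G y (ιv a) ⟩
      ℚF.form ιG y (ιv a)             ≡⟨ ℚF.form-*ˡ ιG r (ιv P) (ιv a) ⟩
      r ℚ.* ℚF.form ιG (ιv P) (ιv a)  ≡⟨ cong (r ℚ.*_) (dotℚ≡form G (ιv P) (ιv a)) ⟨
      r ℚ.* dotℚ G (ιv P) (ιv a)      ≡⟨ cong (r ℚ.*_) (ι-dotℤ G P a) ⟨
      r ℚ.* ι (P · a)                 ≡⟨ cong (λ z → r ℚ.* ι z) (P·a a a∈A) ⟩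
      r ℚ.* ι (S * D * (c ⬝ℤ m))      ≡⟨ r-cancels (c ⬝ℤ m) ⟩
      ι (c ⬝ℤ m)                      ∎
      where
      ιG = λ i j → ι (G i j)

    y∈Aℚ : InAℚ g y
    y∈Aℚ = (λ i → r ℚ.* ι (c i)) , λ j → begin
      r ℚ.* ι (P j)                                ≡⟨ cong (λ z → r ℚ.* ι z) (InA-elim P∈A j) ⟩
      r ℚ.* ι (ℤF.comb c g j)                      ≡⟨ cong (r ℚ.*_) (ιHom.⬝-homo c (λ i → g i j)) ⟩
      r ℚ.* ℚF.sum (λ i → ι (c i) ℚ.* ι (g i j))   ≡⟨ ℚF.*-distribˡ-sum {k} r (λ i → ι (c i) ℚ.* ι (g i j)) ⟩
      ℚF.sum (λ i → r ℚ.* (ι (c i) ℚ.* ι (g i j))) ≡⟨ ℚF.sum-cong-≋ {k} (λ i → ℚₚ.*-assoc r _ _) ⟨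
      ℚF.sum (λ i → r ℚ.* ι (c i) ℚ.* ι (g i j))   ≡⟨ sumℚ≡sum {k} (λ i → r ℚ.* ι (c i) ℚ.* ι (g i j)) ⟨
      sumℚ (λ i → r ℚ.* ι (c i) ℚ.* ι (g i j))     ∎
      where
      c = proj₁ P∈A

  divide-pairing : ∀ {k} {g : Gens n k} → ProjImageIsDual G g → ∀ x s (m : Fin k → ℤ) →
                   (∀ i → x · g i ≡ + suc s * m i) → ∃ λ x′ → ∀ i → x′ · g i ≡ m i
  divide-pairing {g = g} pid x s m x·g≡sm = x′ , λ i → ι-injective (begin
    ι (x′ · g i)               ≡⟨ ι-dotℤ G x′ (g i) ⟩
    dotℚ G (ιv x′) (ιv (g i))  ≡⟨ proj₂ (proj₂ lift) (g i) (InA-generator g i) ⟩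
    dotℚ G y (ιv (g i))        ≡⟨ proj₂ (proj₂ dual) i ⟩
    ι (m i)                    ∎)
    where
    open ≡-Reasoning
    dual = dual-representative g x s m x·g≡sm
    y = proj₁ dual
    lift = proj₁ (pid y) (proj₁ (proj₂ dual))
    x′ = proj₁ lift

  parity-norm-cong : ∀ {u v} → (∀ j → parity (u j) ≡ parity (v j)) → parity (u · u) ≡ parity (v · v)
  parity-norm-cong {u} {v} u≡v = begin
    parity (u · u)     ≡⟨ parity-dotℤ G u u ⟩
    𝔽₂.form Ḡ ū ū      ≡⟨ 𝔽₂.form-cong Ḡ u≡v u≡v ⟩
    𝔽₂.form Ḡ v̄ v̄      ≡⟨ parity-dotℤ G v v ⟨
    parity (v · v)     ∎
    where
    open ≡-Reasoning
    Ḡ = λ i j → parity (G i j)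
    ū = λ j → parity (u j)
    v̄ = λ j → parity (v j)

  even-pairing⇒even-norm : ∀ {k} {g : Gens n k} → ProjImageIsDual G g → BEven G g →
                           ∀ x (m : Fin k → ℤ) → (∀ i → x · g i ≡ + 2 * m i) → parity (x · x) ≡ false
  even-pairing⇒even-norm {g = g} pid even x m x·g≡2m =
    trans (sym (parity-norm-cong {b} {x} b≡x)) (2∣⇒parity≡false {b · b} (even b (orthogonal⇒InB {x = b} b⊥g)))
    where
    open ≡-Reasoning
    lift = divide-pairing pid x 1 m x·g≡2m
    x′ = proj₁ lift
    x′·g≡m = proj₂ lift
    b : Vecℤ n
    b j = x j + (- + 2) * x′ j
    b⊥g : ∀ i → b · g i ≡ 0ℤ
    b⊥g i = begin
      b · g i                             ≡⟨ ·-+ˡ x (λ j → (- + 2) * x′ j) (g i) ⟩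
      x · g i + (λ j → (- + 2) * x′ j) · g i ≡⟨ cong (λ q → x · g i + q) (·-*ˡ (- + 2) x′ (g i)) ⟩
      x · g i + (- + 2) * (x′ · g i)      ≡⟨ cong₂ (λ p q → p + (- + 2) * q) (x·g≡2m i) (x′·g≡m i) ⟩
      + 2 * m i + (- + 2) * m i           ≡⟨ cancel (m i) ⟩
      0ℤ                                  ∎
      where
      cancel : ∀ a → + 2 * a + (- + 2) * a ≡ 0ℤ
      cancel = solve-∀
    b≡x : ∀ j → parity (b j) ≡ parity (x j)
    b≡x j = begin
      parity (x j + (- + 2) * x′ j)              ≡⟨ parity-+ (x j) _ ⟩
      parity (x j) xor parity ((- + 2) * x′ j)   ≡⟨ cong (parity (x j) xor_) (parity-* (- + 2) (x′ j)) ⟩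
      parity (x j) xor false                     ≡⟨ xor-identityʳ _ ⟩
      parity (x j)                               ∎

  module ParityReduction {k} (g : Gens n k) where
    open ≡-Reasoning

    Ḡ : Fin n → Fin n → Bool
    Ḡ i j = parity (G i j)

    W : Fin k → Fin n → Bool
    W i j = Ḡ j ⬝ (λ l → parity (g i l))

    diag : Fin n → Bool
    diag j = Ḡ j j

    parity-pairing : ∀ x i → parity (x · g i) ≡ (λ j → parity (x j)) ⬝ W i
    parity-pairing x i = trans (parity-dotℤ G x (g i)) (𝔽₂.form-⬝ Ḡ _ _)

    parity-norm : ∀ x → parity (x · x) ≡ (λ j → parity (x j)) ⬝ diag
    parity-norm x = trans (parity-dotℤ G x x) (form-diagonal (λ i j → cong parity (G-sym i j)) _)

    span⇒characteristic : ∀ c → (∀ j → diag j ≡ comb c W j) →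
                          IsCharacteristic G (λ j → sumℤ (λ i → bit (c i) * g i j))
    span⇒characteristic c diag≡cW x = same-parity⇒2∣- {x · ξ} {x · x} (begin
      parity (x · ξ)
        ≡⟨ cong parity (·-span x ξ∈A) ⟩
      parity ((λ i → bit (c i)) ⬝ℤ (λ i → x · g i))
        ≡⟨ ParityHom.⬝-homo {k} (λ i → bit (c i)) (λ i → x · g i) ⟩
      (λ i → parity (bit (c i))) ⬝ (λ i → parity (x · g i))
        ≡⟨ 𝔽₂.⬝-cong (λ i → parity-bit (c i)) (parity-pairing x) ⟩
      c ⬝ (λ i → x̄ ⬝ W i)
        ≡⟨ 𝔽₂.⬝-comb x̄ c W ⟨
      x̄ ⬝ comb c W
        ≡⟨ 𝔽₂.⬝-congʳ x̄ (λ j → sym (diag≡cW j)) ⟩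
      x̄ ⬝ diag
        ≡⟨ parity-norm x ⟨
      parity (x · x) ∎)
      where
      x̄ = λ j → parity (x j)
      ξ = λ j → sumℤ (λ i → bit (c i) * g i j)
      ξ∈A : InA g ξ
      ξ∈A = (λ i → bit (c i)) , λ _ → refl

    separated⇒¬BEven : ProjImageIsDual G g → Separated W diag → ¬ BEven G g
    separated⇒¬BEven pid (x̄ , x̄⊥W , x̄⬝diag) even = false≢true (begin
      false                        ≡⟨ even-pairing⇒even-norm pid even x m x·g≡2m ⟨
      parity (x · x)               ≡⟨ parity-norm x ⟩
      (λ j → parity (x j)) ⬝ diag   ≡⟨ 𝔽₂.⬝-cong x̄-lifts (λ _ → refl) ⟩
      x̄ ⬝ diag                     ≡⟨ x̄⬝diag ⟩
      true                         ∎)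
      where
      x : Vecℤ n
      x j = bit (x̄ j)
      x̄-lifts : ∀ j → parity (x j) ≡ x̄ j
      x̄-lifts j = parity-bit (x̄ j)
      x·g-even : ∀ i → parity (x · g i) ≡ false
      x·g-even i = trans (parity-pairing x i) (trans (𝔽₂.⬝-cong x̄-lifts (λ _ → refl)) (x̄⊥W i))
      m = λ i → (x · g i) ℤ./ℕ 2
      x·g≡2m : ∀ i → x · g i ≡ + 2 * m i
      x·g≡2m i = trans (parity≡false⇒halvable (x·g-even i)) (ℤₚ.*-comm (m i) (+ 2))
      false≢true : false ≢ true
      false≢true ()

    BEven⇒characteristic : ProjImageIsDual G g → BEven G g → ∃ λ ξ → InA g ξ × IsCharacteristic G ξ
    BEven⇒characteristic pid even with span-or-separated k W diag
    ... | inj₁ (c , diag≡cW) = _ , ((λ i → bit (c i)) , λ _ → refl) , span⇒characteristic c diag≡cW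
    ... | inj₂ separated     = ⊥-elim (separated⇒¬BEven pid separated even)

characteristic⇒BEven : ∀ {n k} {G : Gram n} {g : Gens n k} →
                       (∃ λ ξ → InA g ξ × IsCharacteristic G ξ) → BEven G g
characteristic⇒BEven {G = G} (ξ , ξ∈A , ξ-char) x x∈B =
  subst (2 ∣ℕ_) ∣0-x·x∣≡∣x·x∣ (subst (λ z → + 2 ∣ℤ (z ℤ.- dotℤ G x x)) (x∈B ξ ξ∈A) (ξ-char x))
  where
  ∣0-x·x∣≡∣x·x∣ : ℤ.∣ 0ℤ ℤ.- dotℤ G x x ∣ ≡ ℤ.∣ dotℤ G x x ∣
  ∣0-x·x∣≡∣x·x∣ = trans (cong ℤ.∣_∣ (ℤₚ.+-identityˡ (ℤ.- dotℤ G x x))) (ℤₚ.∣-i∣≡∣i∣ (dotℤ G x x))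

proposition2p8 : ∀ (n k : ℕ) (G : Gram n) (g : Gens n k) →
    IsLattice G → Saturated g → ProjImageIsDual G g →
    BEven G g ⇔ (∃ λ ξ → InA g ξ × IsCharacteristic G ξ)
proposition2p8 n k G g lattice _ pid =
  mk⇔ (Lattice.ParityReduction.BEven⇒characteristic G lattice g pid) characteristic⇒BEven
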